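{- Let $m$ be a positive integer and $k,n\in\mathbb{Z}$. Then $$\left\lfloor\frac{2kn}{m}\right\rfloor-\left\lfloor\frac{kn}{m}\right\rfloor+\left\lfloor\frac{(k-1)n}{m}\right\rfloor-\left\lfloor\frac{2(k-1)n}{m}\right\rfloor\ \geqslant\ \left\lfloor\frac{n+1}{m}\right\rfloor-\left\lfloor\frac{2k-1}{m}\right\rfloor+\left\lfloor\frac{2k-2}{m}\right\rfloor,$$ unless $m$ is even, $k\equiv m/2+1\pmod m$ and $n\equiv -1\pmod m$, in which case the left-hand side minus the right-hand side equals $-1$. -}

module Defs where

open import Data.Nat.Base as ℕ using (ℕ; NonZero)
open import Data.Integer.Base using (ℤ; _/ℕ_)

-- floor (a / m) for an integer a and a positive natural m.
-- Data.Integer.Base._/ℕ_ is floor division for a positive divisor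
-- (its remainder _%ℕ_ lies in [0, m)).
⌊_/_⌋ : ℤ → (m : ℕ) → .{{NonZero m}} → ℤ
⌊ a / m ⌋ = a /ℕ m

module Submission where

-- Write a ≡ (k-1)n, r ≡ n and t ≡ k-1 for the residues modulo m.
-- Every floor in the statement is of a sum x + y (or x + 1), and
--   ⌊(x + y)/m⌋ = ⌊x/m⌋ + ⌊y/m⌋ + carry(x mod m, y mod m),
-- where the carry ⌊(u + v)/m⌋ of two residues is 0 or 1.  Expanding
-- kn = (k-1)n + n, 2kn = kn + kn, 2(k-1)n = (k-1)n + (k-1)n, n + 1,
-- 2k-2 = (k-1) + (k-1) and 2k-1 = (2k-2) + 1, all the floors telescope and
--   LHS − RHS = gain − loss,
-- a signed sum of five carries of residues.  The theorem thus reduces to a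
-- statement about residues a, r, t < m with a ≡ t·r: gain ≥ loss, except
-- when m = 2t and r = m - 1, where loss = gain + 1; this critical case is
-- exactly the exceptional configuration of the theorem.

open import Data.Nat.Base as ℕ using (ℕ; NonZero; zero; suc)
open import Data.Product using (_×_; _,_; proj₁; proj₂; Σ-syntax)
open import Data.Sum using (_⊎_; inj₁; inj₂)
open import Relation.Binary.PropositionalEquality
open import Relation.Binary.Definitions using (tri<; tri≈; tri>)
open import Relation.Nullary using (¬_; yes; no; contradiction)
open import Function.Base using (_∘_)

module Residues (m : ℕ) .{{_ : NonZero m}} where

  open import Data.Nat.Base using (_+_; _*_; _<_; _≤_; _/_; _%_; pred; z≤n; s≤s; s≤s⁻¹; ≢-nonZero⁻¹)
  open import Data.Nat.Properties
  open import Data.Nat.DivMod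

  carry : ℕ → ℕ → ℕ
  carry x y = (x + y) / m

  carry≤1 : ∀ {x y} → x < m → y < m → carry x y ≤ 1
  carry≤1 {x} {y} x<m y<m =
    s≤s⁻¹ (m<n*o⇒m/o<n (subst (x + y <_) (cong (m +_) (sym (+-identityʳ m))) (+-mono-< x<m y<m)))

  carry≥1 : ∀ x y → m ≤ x + y → 1 ≤ carry x y
  carry≥1 x y = m≥n⇒m/n>0

  overflow : ∀ {z} → z < m → (z + m) / m ≡ 1 × (z + m) % m ≡ z
  overflow {z} z<m =
    trans (m/n≡1+[m∸n]/n (m≤n+m m z)) (cong suc (trans (/-congˡ (m+n∸n≡m z m)) (m<n⇒m/n≡0 z<m))) ,
    trans ([m+n]%n≡m%n z m) (m<n⇒m%n≡m z<m)

  sum-of-residues : ∀ {x y} → x < m → y < m → x + y < m ⊎ Σ[ z ∈ ℕ ] z < m × x + y ≡ z + m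
  sum-of-residues {x} {y} x<m y<m with x + y <? m
  ... | yes x+y<m = inj₁ x+y<m
  ... | no x+y≮m with m≤n⇒∃[o]m+o≡n (≮⇒≥ x+y≮m)
  ...   | z , m+z≡x+y = inj₂ (z , z<m , trans (sym m+z≡x+y) (+-comm m z))
    where
    z<m : z < m
    z<m = +-cancelˡ-< m z m (subst (_< m + m) (sym m+z≡x+y) (+-mono-< x<m y<m))

  divisible-sum : ∀ {x y} → x < m → y < m → (x + y) % m ≡ 0 → x + y ≡ 0 ⊎ x + y ≡ m
  divisible-sum x<m y<m x+y%m≡0 with sum-of-residues x<m y<m
  ... | inj₁ x+y<m = inj₁ (trans (sym (m<n⇒m%n≡m x+y<m)) x+y%m≡0)
  ... | inj₂ (z , z<m , x+y≡z+m) = inj₂ (trans x+y≡z+m (cong (_+ m) z≡0))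
    where
    z≡0 : z ≡ 0
    z≡0 = trans (sym (proj₂ (overflow z<m))) (trans (%-congˡ (sym x+y≡z+m)) x+y%m≡0)

  %-absorbˡ : ∀ x y → (x % m + y) % m ≡ (x + y) % m
  %-absorbˡ x y = begin
    (x % m + y) % m          ≡⟨ %-distribˡ-+ (x % m) y m ⟩
    (x % m % m + y % m) % m  ≡⟨ cong (λ u → (u + y % m) % m) (m%n%n≡m%n x m) ⟩
    (x % m + y % m) % m      ≡⟨ %-distribˡ-+ x y m ⟨
    (x + y) % m              ∎
    where open ≡-Reasoning

  complement-residue : ∀ {a t r} → a ≡ (t * r) % m → suc r ≡ m → (a + t) % m ≡ 0
  complement-residue {a} {t} {r} refl sr≡m = begin
    ((t * r) % m + t) % m  ≡⟨ %-absorbˡ (t * r) t ⟩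
    (t * r + t) % m        ≡⟨ %-congˡ (trans (+-comm (t * r) t) (sym (*-suc t r))) ⟩
    (t * suc r) % m        ≡⟨ %-congˡ (cong (t *_) sr≡m) ⟩
    (t * m) % m            ≡⟨ m*n%n≡0 t m ⟩
    0                      ∎
    where open ≡-Reasoning

  undo-increment : ∀ {t} → t < m → ((t + 1) % m + pred m) % m ≡ t
  undo-increment {t} t<m = begin
    ((t + 1) % m + pred m) % m  ≡⟨ %-absorbˡ (t + 1) (pred m) ⟩
    (t + 1 + pred m) % m        ≡⟨ %-congˡ (trans (+-assoc t 1 (pred m)) (cong (t +_) (suc-pred m))) ⟩
    (t + m) % m                 ≡⟨ [m+n]%n≡m%n t m ⟩
    t % m                       ≡⟨ m<n⇒m%n≡m t<m ⟩
    t                           ∎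
    where open ≡-Reasoning

  increment-injective : ∀ {t h} → t < m → h < m → (t + 1) % m ≡ (h + 1) % m → t ≡ h
  increment-injective t<m h<m eq =
    trans (sym (undo-increment t<m)) (trans (cong (λ u → (u + pred m) % m) eq) (undo-increment h<m))

  half-below : ∀ {h} → m ≡ h + h → h < m
  half-below {zero} m≡0 = contradiction m≡0 (≢-nonZero⁻¹ m)
  half-below {suc h} m≡h+h = subst (suc h <_) (sym m≡h+h) (s≤s (m≤n+m (suc h) h))

  doubling-carry-bound : ∀ {a r} → a < m → r < m →
    carry a a ≤ carry a r + carry ((a + r) % m) ((a + r) % m)
  doubling-carry-bound {a} {r} a<m r<m with a + r <? m
  ... | yes a+r<m = ≤-trans (/-monoˡ-≤ m (+-mono-≤ a≤b a≤b)) (m≤n+m _ (carry a r))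
    where
    a≤b : a ≤ (a + r) % m
    a≤b = subst (a ≤_) (sym (m<n⇒m%n≡m a+r<m)) (m≤m+n a r)
  ... | no a+r≮m = ≤-trans (carry≤1 a<m a<m) (≤-trans (carry≥1 a r (≮⇒≥ a+r≮m)) (m≤m+n _ _))

  last-residue-carries : ∀ {r} → suc r ≡ m → 1 ≤ carry r r + carry 0 1
  last-residue-carries {zero} 1≡m =
    ≤-trans (≤-reflexive (sym (trans (/-congˡ 1≡m) (n/n≡1 m)))) (m≤n+m _ (carry 0 0))
  last-residue-carries {suc r} sr≡m = ≤-trans (carry≥1 (suc r) (suc r) m≤rr) (m≤m+n _ _)
    where
    m≤rr : m ≤ suc r + suc r
    m≤rr = subst (_≤ suc r + suc r) sr≡m (s≤s (m≤n+m (suc r) r))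

  borrow-generic : ∀ b t → suc b < m → suc b + t ≡ m → m ≢ t + t →
    carry (suc b) (suc b) ≤ carry b b + carry ((t + t) % m) 1
  borrow-generic b t sb<m sb+t≡m m≢t+t with <-cmp t b
  ... | tri< t<b _ _ = ≤-trans (carry≤1 sb<m sb<m) (≤-trans (carry≥1 b b m≤b+b) (m≤m+n _ _))
    where
    m≤b+b : m ≤ b + b
    m≤b+b = subst (_≤ b + b) (trans (+-suc b t) sb+t≡m) (+-monoʳ-≤ b t<b)
  ... | tri≈ _ refl _ = ≤-trans (carry≤1 sb<m sb<m) (≤-trans (≤-reflexive (sym σ≡1)) (m≤n+m _ _))
    where
    t+t%m≡t+t : (t + t) % m ≡ t + t
    t+t%m≡t+t = m<n⇒m%n≡m (subst (t + t <_) sb+t≡m ≤-refl)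
    σ≡1 : carry ((t + t) % m) 1 ≡ 1
    σ≡1 = trans (/-congˡ (trans (cong (_+ 1) t+t%m≡t+t) (trans (+-comm (t + t) 1) sb+t≡m))) (n/n≡1 m)
  ... | tri> _ _ b<t with m≤n⇒m<n∨m≡n b<t
  ...   | inj₂ sb≡t = contradiction (trans (sym sb+t≡m) (cong (_+ t) sb≡t)) m≢t+t
  ...   | inj₁ sb<t = ≤-trans (≤-reflexive (m<n⇒m/n≡0 sb+sb<m)) z≤n
    where
    sb+sb<m : suc b + suc b < m
    sb+sb<m = subst (suc b + suc b <_) sb+t≡m (+-monoʳ-< (suc b) sb<t)

  borrow-exceptional : ∀ b t → suc b + t ≡ m → m ≡ t + t →
    suc (carry b b + carry ((t + t) % m) 1) ≡ carry (suc b) (suc b)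
  borrow-exceptional b t sb+t≡m m≡t+t with +-cancelʳ-≡ t (suc b) t (trans sb+t≡m m≡t+t)
  ... | refl = begin
    suc (carry b b + carry ((suc b + suc b) % m) 1) ≡⟨ cong₂ (λ u v → suc (u + carry v 1)) b+b-no-carry 2t%m≡0 ⟩
    suc (0 + carry 0 1)                             ≡⟨ cong suc 1-no-carry ⟩
    1                                               ≡⟨ n/n≡1 m ⟨
    m / m                                           ≡⟨ /-congˡ m≡t+t ⟩
    carry (suc b) (suc b)                           ∎
    where
    open ≡-Reasoning
    b+b-no-carry : carry b b ≡ 0
    b+b-no-carry = m<n⇒m/n≡0 (subst (b + b <_) (sym m≡t+t) (s≤s (+-monoʳ-≤ b (n≤1+n b))))
    2t%m≡0 : (suc b + suc b) % m ≡ 0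
    2t%m≡0 = trans (%-congˡ (sym m≡t+t)) (n%n≡0 m)
    1-no-carry : carry 0 1 ≡ 0
    1-no-carry = m<n⇒m/n≡0 (subst (1 <_) (sym m≡t+t) (s≤s (≤-trans (s≤s z≤n) (m≤n+m (suc b) b))))

  -- For residues a ≡ (k-1)n, r ≡ n, t ≡ k-1 the difference LHS − RHS of the
  -- theorem equals gain − loss, where gain collects the carries of a + r,
  -- of doubling (a + r) mod m and of adding 1 to 2t mod m, and loss those of
  -- doubling a and of adding 1 to r.
  gain : ℕ → ℕ → ℕ → ℕ
  gain a r t = carry a r + carry ((a + r) % m) ((a + r) % m) + carry ((t + t) % m) 1

  loss : ℕ → ℕ → ℕ
  loss a r = carry a a + carry r 1

  Critical : ℕ → ℕ → Set
  Critical t r = m ≡ t + t × suc r ≡ m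

  -- Away from the last residue r = m - 1, adding 1 to r never carries.
  below-last-residue : ∀ {a r} t → a < m → r < m → suc r < m → loss a r ≤ gain a r t
  below-last-residue {a} {r} t a<m r<m sr<m = begin
    carry a a + carry r 1                     ≡⟨ cong (carry a a +_) (m<n⇒m/n≡0 (subst (_< m) (+-comm 1 r) sr<m)) ⟩
    carry a a + 0                             ≡⟨ +-identityʳ (carry a a) ⟩
    carry a a                                 ≤⟨ doubling-carry-bound a<m r<m ⟩
    carry a r + carry ((a + r) % m) ((a + r) % m) ≤⟨ m≤m+n _ _ ⟩
    gain a r t                                ∎
    where open ≤-Reasoning

  last-residue-carry : ∀ {r} → suc r ≡ m → carry r 1 ≡ 1
  last-residue-carry {r} sr≡m = trans (/-congˡ (trans (+-comm r 1) sr≡m)) (n/n≡1 m)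

  -- r = m - 1 and a = t = 0: the carries of r + r or 1 make up for r + 1.
  zero-residue-case : ∀ {r} → r < m → suc r ≡ m →
    (¬ Critical 0 r → loss 0 r ≤ gain 0 r 0) × (Critical 0 r → suc (gain 0 r 0) ≡ loss 0 r)
  zero-residue-case {r} r<m sr≡m = (λ _ → bound) , (λ (m≡0 , _) → contradiction m≡0 (≢-nonZero⁻¹ m))
    where
    open ≤-Reasoning
    r%m≡r : r % m ≡ r
    r%m≡r = m<n⇒m%n≡m r<m
    0%m≡0 : 0 % m ≡ 0
    0%m≡0 = m*n%n≡0 0 m
    bound : loss 0 r ≤ gain 0 r 0
    bound = begin
      carry 0 0 + carry r 1                          ≡⟨ cong₂ _+_ (0/n≡0 m) (last-residue-carry sr≡m) ⟩
      1                                              ≤⟨ last-residue-carries sr≡m ⟩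
      carry r r + carry 0 1                          ≡⟨ cong₂ (λ u v → carry u u + carry v 1) r%m≡r 0%m≡0 ⟨
      carry (r % m) (r % m) + carry (0 % m) 1        ≤⟨ +-monoˡ-≤ (carry (0 % m) 1) (m≤n+m _ (carry 0 r)) ⟩
      gain 0 r 0                                     ∎

  -- r = m - 1 and a + t = m: write a = b + 1, so that a + r = b + m carries once.
  wrap-case : ∀ {a r t} → a < m → t < m → suc r ≡ m → a + t ≡ m →
    (¬ Critical t r → loss a r ≤ gain a r t) × (Critical t r → suc (gain a r t) ≡ loss a r)
  wrap-case {zero} _ t<m _ t≡m = contradiction t≡m (<⇒≢ t<m)
  wrap-case {suc b} {r} {t} sb<m _ sr≡m sb+t≡m =
    (λ not-critical → begin
      loss (suc b) r                               ≡⟨ loss≡ ⟩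
      suc (carry (suc b) (suc b))                  ≤⟨ s≤s (borrow-generic b t sb<m sb+t≡m (not-critical ∘ (_, sr≡m))) ⟩
      suc (carry b b + carry ((t + t) % m) 1)      ≡⟨ gain≡ ⟨
      gain (suc b) r t                             ∎) ,
    (λ (m≡t+t , _) → trans (cong suc gain≡) (trans (cong suc (borrow-exceptional b t sb+t≡m m≡t+t)) (sym loss≡)))
    where
    open ≤-Reasoning
    sb+r≡b+m : suc b + r ≡ b + m
    sb+r≡b+m = trans (sym (+-suc b r)) (cong (b +_) sr≡m)
    wrap : (b + m) / m ≡ 1 × (b + m) % m ≡ b
    wrap = overflow (<⇒≤ sb<m)
    gain≡ : gain (suc b) r t ≡ suc (carry b b + carry ((t + t) % m) 1)
    gain≡ = cong₂ (λ c u → c + carry u u + carry ((t + t) % m) 1)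
                  (trans (/-congˡ sb+r≡b+m) (proj₁ wrap)) (trans (%-congˡ sb+r≡b+m) (proj₂ wrap))
    loss≡ : loss (suc b) r ≡ suc (carry (suc b) (suc b))
    loss≡ = trans (cong (carry (suc b) (suc b) +_) (last-residue-carry sr≡m)) (+-comm _ 1)

  residue-inequality : ∀ {a r t} → a < m → r < m → t < m → a ≡ (t * r) % m →
    (¬ Critical t r → loss a r ≤ gain a r t) × (Critical t r → suc (gain a r t) ≡ loss a r)
  residue-inequality {a} {r} {t} a<m r<m t<m a≡tr with m≤n⇒m<n∨m≡n r<m
  ... | inj₁ sr<m = (λ _ → below-last-residue t a<m r<m sr<m) , (λ (_ , sr≡m) → contradiction sr≡m (<⇒≢ sr<m))
  ... | inj₂ sr≡m with divisible-sum a<m t<m (complement-residue a≡tr sr≡m)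
  ...   | inj₂ a+t≡m = wrap-case a<m t<m sr≡m a+t≡m
  ...   | inj₁ a+t≡0 with m+n≡0⇒m≡0 a a+t≡0 | m+n≡0⇒n≡0 a a+t≡0
  ...     | refl | refl = zero-residue-case r<m sr≡m

open import Defs
open import Data.Nat.Base using (_/_)
open import Data.Nat.Divisibility using (_∣_; divides)
open import Data.Integer.Base using (ℤ; +_; _+_; _-_; _*_; -_; _≥_; _≤_; _<_; _%ℕ_; _/ℕ_; +<+; +≤+)
  renaming (suc to sucℤ)
import Data.Nat.Properties as ℕP
import Data.Nat.DivMod as ℕD
import Data.Integer.Properties as ℤP
open import Data.Integer.DivMod using (a≡a%ℕn+[a/ℕn]*n; n%ℕd<d; [n/ℕd]*d≤n; n<s[n/ℕd]*d)
open import Data.Integer.Tactic.RingSolver using (solve-∀)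
open import Algebra.Properties.AbelianGroup ℤP.+-0-abelianGroup using (∙-cancelʳ)

module FloorDivision (m : ℕ) .{{_ : NonZero m}} where

  private
    M : ℤ
    M = + m

  quotient-below : ∀ {x} q p → q * M ≤ x → x < sucℤ p * M → q ≤ p
  quotient-below q p qm≤x x<p₁m =
    subst (q ≤_) (ℤP.pred-suc p)
      (ℤP.i<j⇒i≤pred[j] (ℤP.*-cancelʳ-<-nonNeg {i = q} {j = sucℤ p} M (ℤP.≤-<-trans qm≤x x<p₁m)))

  quotient-unique : ∀ {x r} q → r ℕ.< m → x ≡ + r + q * M → x /ℕ m ≡ q
  quotient-unique {x} {r} q r<m refl = ℤP.≤-antisym
    (quotient-below (x /ℕ m) q ([n/ℕd]*d≤n x m) x<q₁m)
    (quotient-below q (x /ℕ m) qm≤x (n<s[n/ℕd]*d x m))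
    where
    qm≤x : q * M ≤ x
    qm≤x = ℤP.i≤j+i (q * M) (+ r)
    x<q₁m : x < sucℤ q * M
    x<q₁m = subst (x <_) (sym (ℤP.suc-* q M)) (ℤP.+-monoˡ-< (q * M) (+<+ r<m))

  remainder-unique : ∀ {x r} q → r ℕ.< m → x ≡ + r + q * M → x %ℕ m ≡ r
  remainder-unique {x} {r} q r<m x≡ = ℤP.+-injective (∙-cancelʳ (q * M) (+ (x %ℕ m)) (+ r) (begin
    + (x %ℕ m) + q * M          ≡⟨ cong (λ z → + (x %ℕ m) + z * M) (quotient-unique q r<m x≡) ⟨
    + (x %ℕ m) + (x /ℕ m) * M   ≡⟨ a≡a%ℕn+[a/ℕn]*n x m ⟨
    x                           ≡⟨ x≡ ⟩
    + r + q * M                 ∎))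
    where open ≡-Reasoning

  divmod-shift : ∀ {x} q r → x ≡ + r + q * M → x /ℕ m ≡ q + + (r / m) × x %ℕ m ≡ r ℕ.% m
  divmod-shift {x} q r x≡ =
    quotient-unique q′ (ℕD.m%n<n r m) x≡′ , remainder-unique q′ (ℕD.m%n<n r m) x≡′
    where
    regroup : ∀ r′ c q M → (r′ + c * M) + q * M ≡ r′ + (q + c) * M
    regroup = solve-∀
    q′ : ℤ
    q′ = q + + (r / m)
    x≡′ : x ≡ + (r ℕ.% m) + q′ * M
    x≡′ = trans x≡ (trans (cong (_+ q * M) (a≡a%ℕn+[a/ℕn]*n (+ r) m))
                          (regroup (+ (r ℕ.% m)) (+ (r / m)) q M))

  divmod-+ : ∀ {z} x y → z ≡ x + y →
    z /ℕ m ≡ x /ℕ m + y /ℕ m + + ((x %ℕ m ℕ.+ y %ℕ m) / m) × z %ℕ m ≡ (x %ℕ m ℕ.+ y %ℕ m) ℕ.% m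
  divmod-+ x y refl = divmod-shift (x /ℕ m + y /ℕ m) (x %ℕ m ℕ.+ y %ℕ m) (trans
    (cong₂ _+_ (a≡a%ℕn+[a/ℕn]*n x m) (a≡a%ℕn+[a/ℕn]*n y m))
    (regroup (+ (x %ℕ m)) (+ (y %ℕ m)) (x /ℕ m) (y /ℕ m) M))
    where
    regroup : ∀ r s p q M → (r + p * M) + (s + q * M) ≡ (r + s) + (p + q) * M
    regroup = solve-∀

  divmod-+ℕ : ∀ {z} x j → z ≡ x + + j →
    z /ℕ m ≡ x /ℕ m + + ((x %ℕ m ℕ.+ j) / m) × z %ℕ m ≡ (x %ℕ m ℕ.+ j) ℕ.% m
  divmod-+ℕ x j refl = divmod-shift (x /ℕ m) (x %ℕ m ℕ.+ j) (trans
    (cong (_+ + j) (a≡a%ℕn+[a/ℕn]*n x m))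
    (regroup (+ (x %ℕ m)) (+ j) (x /ℕ m) M))
    where
    regroup : ∀ r j q M → (r + q * M) + j ≡ (r + j) + q * M
    regroup = solve-∀

  mod-* : ∀ x y → (x * y) %ℕ m ≡ ((x %ℕ m) ℕ.* (y %ℕ m)) ℕ.% m
  mod-* x y = proj₂ (divmod-shift c (r ℕ.* s) (begin
    x * y                          ≡⟨ cong₂ _*_ (a≡a%ℕn+[a/ℕn]*n x m) (a≡a%ℕn+[a/ℕn]*n y m) ⟩
    (+ r + p * M) * (+ s + q * M)  ≡⟨ expand (+ r) (+ s) p q M ⟩
    + r * + s + c * M              ≡⟨ cong (_+ c * M) (ℤP.pos-* r s) ⟨
    + (r ℕ.* s) + c * M            ∎))
    where
    open ≡-Reasoning
    r s : ℕ
    r = x %ℕ m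
    s = y %ℕ m
    p q c : ℤ
    p = x /ℕ m
    q = y /ℕ m
    c = + r * q + p * + s + p * q * M
    expand : ∀ r s p q M → (r + p * M) * (s + q * M) ≡ r * s + (r * q + p * s + p * q * M) * M
    expand = solve-∀

neg-one-residue : ∀ m .{{_ : NonZero m}} → (- + 1) %ℕ m ≡ ℕ.pred m
neg-one-residue (suc zero)    = refl
neg-one-residue (suc (suc _)) = refl

-- Telescoping: once each floor of the statement is expanded as a sum of
-- floors plus a carry, the two sides differ by a signed sum of carries.
telescoping : ∀ {F2kn Fkn FA F2A Fn Fn1 F2k1 F2k2 c δb δa ρ σ : ℤ} →
  Fkn ≡ FA + Fn + c → F2kn ≡ Fkn + Fkn + δb → F2A ≡ FA + FA + δa →
  Fn1 ≡ Fn + ρ → F2k1 ≡ F2k2 + σ →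
  (F2kn - Fkn + FA - F2A) - (Fn1 - F2k1 + F2k2) ≡ (c + δb + σ) - (δa + ρ)
telescoping {FA = FA} {Fn = Fn} {F2k2 = F2k2} {c} {δb} {δa} {ρ} {σ} refl refl refl refl refl =
  identity FA Fn F2k2 c δb δa ρ σ
  where
  identity : ∀ FA Fn F2k2 c δb δa ρ σ →
    let Fkn = FA + Fn + c in
    (Fkn + Fkn + δb - Fkn + FA - (FA + FA + δa)) - ((Fn + ρ) - (F2k2 + σ) + F2k2)
      ≡ (c + δb + σ) - (δa + ρ)
  identity = solve-∀

double : ∀ h → h ℕ.* 2 ≡ h ℕ.+ h
double h = trans (ℕP.*-comm h 2) (cong (h ℕ.+_) (ℕP.+-identityʳ h))

half : ∀ {m h} → m ≡ h ℕ.* 2 → m / 2 ≡ h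
half {h = h} m≡h*2 = trans (ℕD./-congˡ m≡h*2) (ℕD.m*n/n≡m h 2)

nonnegative : ∀ {g l} → l ℕ.≤ g → + 0 ≤ + g - + l
nonnegative {g} {l} l≤g = subst (+ 0 ≤_) (sym (trans (ℤP.m-n≡m⊖n g l) (ℤP.⊖-≥ l≤g))) (+≤+ ℕ.z≤n)

one-short : ∀ g → + g - + suc g ≡ - + 1
one-short g = identity (+ g)
  where
  identity : ∀ x → x - (+ 1 + x) ≡ - + 1
  identity = solve-∀

module Reduction (m : ℕ) .{{_ : NonZero m}} (k n : ℤ) where

  open Residues m
  open FloorDivision m

  t r a : ℕ
  t = (k - + 1) %ℕ m
  r = n %ℕ m
  a = ((k - + 1) * n) %ℕ m

  LHS RHS : ℤ
  LHS = ⌊ + 2 * k * n / m ⌋ - ⌊ k * n / m ⌋ + ⌊ (k - + 1) * n / m ⌋ - ⌊ + 2 * (k - + 1) * n / m ⌋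
  RHS = ⌊ n + + 1 / m ⌋ - ⌊ + 2 * k - + 1 / m ⌋ + ⌊ + 2 * k - + 2 / m ⌋

  Exceptional : Set
  Exceptional = 2 ∣ m × (k %ℕ m ≡ (+ (m / 2) + + 1) %ℕ m) × (n %ℕ m ≡ (- + 1) %ℕ m)

  a≡tr : a ≡ (t ℕ.* r) ℕ.% m
  a≡tr = mod-* (k - + 1) n

  carry-bounds : (¬ Critical t r → loss a r ℕ.≤ gain a r t) × (Critical t r → suc (gain a r t) ≡ loss a r)
  carry-bounds = residue-inequality (n%ℕd<d ((k - + 1) * n) m) (n%ℕd<d n m) (n%ℕd<d (k - + 1) m) a≡tr

  excess : LHS - RHS ≡ + gain a r t - + loss a r
  excess = telescoping kn 2kn 2[k-1]n n+1 2k-1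
    where
    K : ℤ
    K = k - + 1
    split-kn : ∀ k n → k * n ≡ (k - + 1) * n + n
    split-kn = solve-∀
    split-2xy : ∀ x y → + 2 * x * y ≡ x * y + x * y
    split-2xy = solve-∀
    split-2k-2 : ∀ k → + 2 * k - + 2 ≡ (k - + 1) + (k - + 1)
    split-2k-2 = solve-∀
    split-2k-1 : ∀ k → + 2 * k - + 1 ≡ (+ 2 * k - + 2) + + 1
    split-2k-1 = solve-∀
    kn-sum : ⌊ k * n / m ⌋ ≡ ⌊ K * n / m ⌋ + ⌊ n / m ⌋ + + carry a r × (k * n) %ℕ m ≡ (a ℕ.+ r) ℕ.% m
    kn-sum = divmod-+ (K * n) n (split-kn k n)
    2k-2-rem : (+ 2 * k - + 2) %ℕ m ≡ (t ℕ.+ t) ℕ.% m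
    2k-2-rem = proj₂ (divmod-+ K K (split-2k-2 k))
    kn : ⌊ k * n / m ⌋ ≡ ⌊ K * n / m ⌋ + ⌊ n / m ⌋ + + carry a r
    kn = proj₁ kn-sum
    2kn : ⌊ + 2 * k * n / m ⌋ ≡ ⌊ k * n / m ⌋ + ⌊ k * n / m ⌋ + + carry ((a ℕ.+ r) ℕ.% m) ((a ℕ.+ r) ℕ.% m)
    2kn = trans (proj₁ (divmod-+ (k * n) (k * n) (split-2xy k n)))
                (cong (λ u → ⌊ k * n / m ⌋ + ⌊ k * n / m ⌋ + + carry u u) (proj₂ kn-sum))
    2[k-1]n : ⌊ + 2 * K * n / m ⌋ ≡ ⌊ K * n / m ⌋ + ⌊ K * n / m ⌋ + + carry a a
    2[k-1]n = proj₁ (divmod-+ (K * n) (K * n) (split-2xy K n))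
    n+1 : ⌊ n + + 1 / m ⌋ ≡ ⌊ n / m ⌋ + + carry r 1
    n+1 = proj₁ (divmod-+ℕ n 1 refl)
    2k-1 : ⌊ + 2 * k - + 1 / m ⌋ ≡ ⌊ + 2 * k - + 2 / m ⌋ + + carry ((t ℕ.+ t) ℕ.% m) 1
    2k-1 = trans (proj₁ (divmod-+ℕ (+ 2 * k - + 2) 1 (split-2k-1 k)))
                 (cong (λ u → ⌊ + 2 * k - + 2 / m ⌋ + + carry u 1) 2k-2-rem)

  k-residue : k %ℕ m ≡ (t ℕ.+ 1) ℕ.% m
  k-residue = proj₂ (divmod-+ℕ (k - + 1) 1 (shift k))
    where
    shift : ∀ k → k ≡ (k - + 1) + + 1
    shift = solve-∀

  critical⇒exceptional : Critical t r → Exceptional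
  critical⇒exceptional (m≡t+t , sr≡m) = divides t m≡t*2 , k-exceptional , n-exceptional
    where
    m≡t*2 : m ≡ t ℕ.* 2
    m≡t*2 = trans m≡t+t (sym (double t))
    k-exceptional : k %ℕ m ≡ (+ (m / 2) + + 1) %ℕ m
    k-exceptional = trans k-residue (cong (λ h → (h ℕ.+ 1) ℕ.% m) (sym (half m≡t*2)))
    n-exceptional : n %ℕ m ≡ (- + 1) %ℕ m
    n-exceptional = trans (cong ℕ.pred sr≡m) (sym (neg-one-residue m))

  exceptional⇒critical : Exceptional → Critical t r
  exceptional⇒critical (divides h m≡h*2 , k-exceptional , n-exceptional) = m≡t+t , sr≡m
    where
    m≡h+h : m ≡ h ℕ.+ h
    m≡h+h = trans m≡h*2 (double h)
    t≡h : t ≡ h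
    t≡h = increment-injective (n%ℕd<d (k - + 1) m) (half-below m≡h+h)
      (trans (sym k-residue) (trans k-exceptional (cong (λ u → (u ℕ.+ 1) ℕ.% m) (half m≡h*2))))
    m≡t+t : m ≡ t ℕ.+ t
    m≡t+t = trans m≡h+h (sym (cong₂ ℕ._+_ t≡h t≡h))
    sr≡m : suc r ≡ m
    sr≡m = trans (cong suc (trans n-exceptional (neg-one-residue m))) (ℕP.suc-pred m)

theorem2p1 : (m : ℕ) → .{{_ : NonZero m}} → (k n : ℤ) →
    let LHS = ⌊ + 2 * k * n / m ⌋ - ⌊ k * n / m ⌋ + ⌊ (k - + 1) * n / m ⌋ - ⌊ + 2 * (k - + 1) * n / m ⌋
        RHS = ⌊ n + + 1 / m ⌋ - ⌊ + 2 * k - + 1 / m ⌋ + ⌊ + 2 * k - + 2 / m ⌋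
        Exceptional = 2 ∣ m × (k %ℕ m ≡ (+ (m / 2) + + 1) %ℕ m) × (n %ℕ m ≡ (- + 1) %ℕ m)
    in (¬ Exceptional → LHS ≥ RHS) × (Exceptional → LHS - RHS ≡ - + 1)
theorem2p1 m k n = sides-ordered , sides-one-apart
  where
  open Reduction m k n
  open Residues m using (gain; loss)

  sides-ordered : ¬ Exceptional → LHS ≥ RHS
  sides-ordered not-exceptional = ℤP.0≤i-j⇒j≤i (subst (+ 0 ≤_) (sym excess)
    (nonnegative (proj₁ carry-bounds (not-exceptional ∘ critical⇒exceptional))))

  sides-one-apart : Exceptional → LHS - RHS ≡ - + 1
  sides-one-apart exceptional = begin
    LHS - RHS                          ≡⟨ excess ⟩
    + gain a r t - + loss a r          ≡⟨ cong (λ l → + gain a r t - + l) loss≡gain+1 ⟨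
    + gain a r t - + suc (gain a r t)  ≡⟨ one-short (gain a r t) ⟩
    - + 1                              ∎
    where
    open ≡-Reasoning
    loss≡gain+1 : suc (gain a r t) ≡ loss a r
    loss≡gain+1 = proj₂ carry-bounds (exceptional⇒critical exceptional)
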